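{- Let $g$ be a convex geometry on a finite set $I$ and $n\in\mathbb{N}$. Then $\chi^\eta_I(g)(n)$ equals the number of extremal functions $f:I\to[n]$, and $\chi^\zeta_I(g)(n)$ equals the number of strictly extremal functions $f:I\to[n]$.
   Context: A convex geometry on finite $I$ is $g:2^I\to2^I$ with $A\subseteq g(A)$, $g(g(A))=g(A)$, $A\subseteq B\Rightarrow g(A)\subseteq g(B)$, $g(\emptyset)=\emptyset$, and anti-exchange: if $a\ne b$, $a,b\notin g(A)$ and $a\in g(A\cup\{b\})$ then $b\notin g(A\cup\{a\})$. Convex sets: $g(K)=K$. For convex $A\subseteq B$, the minor $g_{A:B}$ is the convex geometry on $B\setminus A$ given by $g_{A:B}(X)=g(A\cup X)\cap(B\setminus A)$. $g$ is discrete if $g(X)=X$ for all $X$. For convex $K$, $\mathrm{Ex}(K)=\{a\in K: K\setminus\{a\}\text{ is convex}\}$. Characters: $\eta_I(g)=1$ for all $g$; $\zeta_I(g)=1$ if $g$ is discrete and $0$ otherwise (this $\zeta$ is the convolution inverse of $\overline\eta$, $\overline\eta_I=(-1)^{|I|}\eta_I$). For a character $\psi$, the polynomial invariant is $\chi^\psi_I(g)(n)=\sum\prod_{i=1}^n\psi_{S_i}(g_{A_{i-1}:A_i})$, the sum over all sequences $(S_1,\dots,S_n)$ of pairwise disjoint, possibly empty subsets of $I$ with union $I$ such that every $A_i=S_1\cup\dots\cup S_i$ is convex ($A_0=\emptyset$); the minor on an empty set is the empty geometry with $\psi=1$. For $f:I\to[n]$ and nonempty convex $K$, let $f^K=\max_{x\in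 K}f(x)$. $f$ is extremal if for every nonempty convex $K$, $\{x\in K:f(x)=f^K\}\cap\mathrm{Ex}(K)\ne\emptyset$; $f$ is strictly extremal if for every nonempty convex $K$, $\{x\in K:f(x)=f^K\}\subseteq\mathrm{Ex}(K)$. -}

module Defs where

open import Data.Nat using (ℕ; zero; suc)
open import Data.Bool using (Bool; true; false)
import Data.Bool.Properties as BoolP
open import Data.Fin using (Fin; zero; suc; inject₁; _≤_)
open import Data.Fin.Properties using (all?; any?; _≟_) renaming (_≤?_ to _≤Fin?_)
open import Data.Fin.Subset
  using (Subset; ⊥; ⊤; _∈_; _∉_; _⊆_; _∩_; _∪_; _─_; ⁅_⁆; Nonempty; inside; outside)
open import Data.Fin.Subset.Properties using (_∈?_; nonempty?; anySubset?)
open import Data.Nat.ListAction using (sum)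
open import Data.List using (List; []; _∷_; map; length; filter; concatMap)
open import Data.Vec using (Vec; []; _∷_; lookup)
import Data.Vec.Properties as VecP
open import Data.Product using (Σ; ∃; _×_; _,_)
open import Relation.Binary.PropositionalEquality using (_≡_; _≢_)
open import Relation.Nullary using (Dec; yes; no; ¬_)
open import Relation.Nullary.Decidable using (_×-dec_; _→-dec_; ¬?; decidable-stable)
open import Relation.Unary using (Decidable)

vecsOver : {A : Set} → List A → (k : ℕ) → List (Vec A k)
vecsOver xs zero    = [] ∷ []
vecsOver xs (suc k) = concatMap (λ x → map (x ∷_) (vecsOver xs k)) xs

allSubsets : (m : ℕ) → List (Subset m)
allSubsets m = vecsOver (inside ∷ outside ∷ []) m

-- all functions Fin m → Fin n, as vectors (f x = lookup f x)
allFunctions : (m n : ℕ) → List (Vec (Fin n) m)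
allFunctions m n = vecsOver (Data.List.allFin n) m

count : {A : Set} {P : A → Set} → Decidable P → List A → ℕ
count P? xs = length (filter P? xs)

_≟ˢ_ : {m : ℕ} (X Y : Subset m) → Dec (X ≡ Y)
_≟ˢ_ = VecP.≡-dec BoolP._≟_

allSubset? : {m : ℕ} {P : Subset m → Set} → Decidable P → Dec (∀ K → P K)
allSubset? {P = P} P? with anySubset? (λ K → ¬? (P? K))
... | yes (K , ¬PK) = no (λ ∀P → ¬PK (∀P K))
... | no ¬∃ = yes (λ K → decidable-stable (P? K) (λ ¬PK → ¬∃ (K , ¬PK)))

record ConvexGeometry (m : ℕ) : Set where
  field
    g             : Subset m → Subset m
    extensive     : ∀ A → A ⊆ g A
    idempotent    : ∀ A → g (g A) ≡ g A
    monotone      : ∀ A B → A ⊆ B → g A ⊆ g B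
    empty-closed  : g ⊥ ≡ ⊥
    anti-exchange : ∀ A (a b : Fin m) → a ≢ b → a ∉ g A → b ∉ g A →
                    a ∈ g (A ∪ ⁅ b ⁆) → b ∉ g (A ∪ ⁅ a ⁆)

module _ {m : ℕ} (G : ConvexGeometry m) where
  open ConvexGeometry G

  Convex : Subset m → Set
  Convex K = g K ≡ K

  convex? : Decidable Convex
  convex? K = g K ≟ˢ K

  -- the minor g_{A:B} on B ∖ A, as a closure on subsets of I:
  --   g_{A:B}(X) = g(A ∪ X) ∩ (B ∖ A)
  minor : Subset m → Subset m → Subset m → Subset m
  minor A B X = g (A ∪ X) ∩ (B ─ A)

  DiscreteMinor : Subset m → Subset m → Set
  DiscreteMinor A B = ∀ X → X ⊆ (B ─ A) → minor A B X ≡ X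

  discreteMinor? : ∀ A B → Dec (DiscreteMinor A B)
  discreteMinor? A B = allSubset? (λ X → Data.Fin.Subset.Properties._⊆?_ X (B ─ A) →-dec (minor A B X ≟ˢ X))

  _∈Ex_ : Fin m → Subset m → Set
  a ∈Ex K = a ∈ K × Convex (K ─ ⁅ a ⁆)

  ∈Ex? : ∀ a K → Dec (a ∈Ex K)
  ∈Ex? a K = (a ∈? K) ×-dec convex? (K ─ ⁅ a ⁆)

  -- prefix S i = A_i = S_1 ∪ … ∪ S_i   (i = 0,…,n;  A_0 = ∅)
  prefix : {n : ℕ} → Vec (Subset m) n → Fin (suc n) → Subset m
  prefix S       zero    = ⊥
  prefix (s ∷ S) (suc i) = s ∪ prefix S i

  ValidSeq : {n : ℕ} → Vec (Subset m) n → Set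
  ValidSeq {n} S =
    (∀ (i j : Fin n) → i ≢ j → lookup S i ∩ lookup S j ≡ ⊥) ×
    (prefix S (Data.Fin.fromℕ n) ≡ ⊤) ×
    (∀ (i : Fin (suc n)) → Convex (prefix S i))

  validSeq? : {n : ℕ} → Decidable (ValidSeq {n})
  validSeq? {n} S =
    all? (λ i → all? (λ j → ¬? (i ≟ j) →-dec ((lookup S i ∩ lookup S j) ≟ˢ ⊥)))
    ×-dec ((prefix S (Data.Fin.fromℕ n) ≟ˢ ⊤)
    ×-dec all? (λ i → convex? (prefix S i)))

  allSeqs : (n : ℕ) → List (Vec (Subset m) n)
  allSeqs n = vecsOver (allSubsets m) n

  prodFin : (n : ℕ) → (Fin n → ℕ) → ℕ
  prodFin zero    h = 1
  prodFin (suc n) h = Data.Nat._*_ (h zero) (prodFin n (λ i → h (suc i)))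

  -- A character ψ is given here by its values ψ(g_{A:B}) on the minors
  -- of g, as a function of the convex pair (A , B).
  MinorCharacter : Set
  MinorCharacter = Subset m → Subset m → ℕ

  chi : MinorCharacter → (n : ℕ) → ℕ
  chi ψ n = sum (map (λ S → prodFin n (λ i → ψ (prefix S (inject₁ i)) (prefix S (suc i))))
                     (filter validSeq? (allSeqs n)))

  η : MinorCharacter
  η A B = 1

  ζ : MinorCharacter
  ζ A B with discreteMinor? A B
  ... | yes _ = 1
  ... | no  _ = 0

  AttainsMax : {n : ℕ} → Vec (Fin n) m → Subset m → Fin m → Set
  AttainsMax f K x = x ∈ K × (∀ y → y ∈ K → lookup f y ≤ lookup f x)

  attainsMax? : {n : ℕ} (f : Vec (Fin n) m) (K : Subset m) (x : Fin m) → Dec (AttainsMax f K x)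
  attainsMax? f K x = (x ∈? K) ×-dec all? (λ y → (y ∈? K) →-dec (lookup f y ≤Fin? lookup f x))

  Extremal : {n : ℕ} → Vec (Fin n) m → Set
  Extremal f = ∀ K → Convex K → Nonempty K →
               ∃ λ x → AttainsMax f K x × x ∈Ex K

  StrictlyExtremal : {n : ℕ} → Vec (Fin n) m → Set
  StrictlyExtremal f = ∀ K → Convex K → Nonempty K →
                       ∀ x → AttainsMax f K x → x ∈Ex K

  extremal? : {n : ℕ} → Decidable (Extremal {n})
  extremal? f = allSubset? (λ K → convex? K →-dec (nonempty? K →-dec
                  any? (λ x → attainsMax? f K x ×-dec ∈Ex? x K)))

  strictlyExtremal? : {n : ℕ} → Decidable (StrictlyExtremal {n})
  strictlyExtremal? f = allSubset? (λ K → convex? K →-dec (nonempty? K →-dec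
                  all? (λ x → attainsMax? f K x →-dec ∈Ex? x K)))

-- A function f : I → [n] determines the sequence of its level sets f⁻¹(1), …, f⁻¹(n), whose prefix
-- unions are the strict sublevel sets {f < t}; every sequence counted by χ arises this way from exactly
-- one f. All prefixes are convex exactly when f is extremal: a maximiser of f on a convex K can be
-- traded for an extreme point of K outside the convex set {x ∈ K : f x < max_K f}, and such a point
-- exists by anti-exchange. Strict extremality adds exactly the discreteness of every minor between
-- consecutive sublevel sets. Hence η weights f by [f extremal] and ζ by [f strictly extremal].

module Submission where

open import Defs
open import Data.Fin.Subset
  using (Subset; ⊥; ⊤; _∈_; _∉_; _⊆_; _⊂_; _⊃_; _∩_; _∪_; _─_; ⁅_⁆; Nonempty; inside; outside)
open import Data.Fin.Subset.Properties
open import Data.Fin.Subset.Induction using (Acc; acc; ⊃-wellFounded)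
open import Data.Bool using (true; false; if_then_else_)
import Data.Bool.Properties as Bool
open import Data.Empty using (⊥-elim)
open import Data.Fin using (Fin; zero; suc; toℕ; fromℕ; inject₁)
import Data.Fin.Properties as Fin
open import Data.Fin.Properties using (any?; all?)
open import Data.List using (List; []; _∷_; map; filter; _++_; concatMap; allFin)
open import Data.List.Properties using (map-cong; map-∘; map-++; map-tabulate)
open import Data.Nat using (ℕ; zero; suc; _+_; _*_; _≤_; _<_; z≤n; s≤s; _≟_; _<?_)
open import Data.Nat.ListAction using (sum)
open import Data.Nat.ListAction.Properties using (sum-++)
open import Data.Nat.Properties
  using ( ≤-refl; ≤-trans; ≤-<-trans; m<n⇒m<1+n; <-irrefl; ≮⇒≥; ≤-pred
        ; +-commutativeSemigroup; *-zeroʳ; *-identityˡ; *-identityʳ; *-distribʳ-+; *-distribˡ-+)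
open import Algebra.Properties.CommutativeSemigroup +-commutativeSemigroup
  renaming (interchange to +-interchange)
import Data.List.Relation.Unary.All as All
open import Data.List.Relation.Unary.All.Properties using (all-filter)
open import Data.List.Membership.Propositional.Properties using (∈-filter⁺; ∈-allFin)
open import Data.Product using (∃; _×_; _,_; proj₁; proj₂)
open import Data.Sum using (inj₁; inj₂; [_,_]′)
open import Data.Vec using (Vec; []; _∷_; here; there; lookup; tabulate)
import Data.Vec.Properties as Vec
open import Data.Vec.Relation.Binary.Pointwise.Extensional using (ext; Pointwise-≡⇒≡)
open import Function using (_∘_; _⇔_; mk⇔; Injective; module Equivalence)
open import Relation.Binary using (DecidableEquality)
open import Relation.Binary.PropositionalEquality
  using (_≡_; _≢_; refl; sym; trans; cong; cong₂; subst; subst₂; module ≡-Reasoning)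
open import Relation.Nullary using (Dec; yes; no; does; ¬_)
open import Relation.Nullary.Decidable using (does-⇔; dec-true; decidable-stable; ¬?; _×-dec_)
open import Relation.Unary using (Decidable)

private
  variable
    A B : Set
    P Q : Set

infixr 7 [_]·_

[_]·_ : Dec P → ℕ → ℕ
[ p? ]· k = if does p? then k else 0

[]·-yes : (p? : Dec P) → P → ∀ k → [ p? ]· k ≡ k
[]·-yes (yes _) _ k = refl
[]·-yes (no ¬p) p k = ⊥-elim (¬p p)

[]·-no : (p? : Dec P) → ¬ P → ∀ k → [ p? ]· k ≡ 0
[]·-no (yes p) ¬p k = ⊥-elim (¬p p)
[]·-no (no _) _ k = refl

[]·≢0⇒ : (p? : Dec P) {k : ℕ} → [ p? ]· k ≢ 0 → P
[]·≢0⇒ (yes p) _ = p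
[]·≢0⇒ (no _) k≢0 = ⊥-elim (k≢0 refl)

[]·-cong : P ⇔ Q → (p? : Dec P) (q? : Dec Q) (k : ℕ) → [ p? ]· k ≡ [ q? ]· k
[]·-cong P⇔Q p? q? k = cong (if_then k else 0) (does-⇔ P⇔Q p? q?)

[]·-×-dec : (p? : Dec P) (q? : Dec Q) (k : ℕ) → [ p? ]· [ q? ]· k ≡ [ p? ×-dec q? ]· k
[]·-×-dec p? q? k with does p?
... | true  = refl
... | false = refl

sum-map-cong : {f h : A → ℕ} → (∀ x → f x ≡ h x) → (xs : List A) → sum (map f xs) ≡ sum (map h xs)
sum-map-cong f≗h xs = cong sum (map-cong f≗h xs)

sum-map-filter : {P : A → Set} (P? : Decidable P) (h : A → ℕ) (xs : List A) →
  sum (map h (filter P? xs)) ≡ sum (map (λ x → [ P? x ]· h x) xs)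
sum-map-filter P? h []       = refl
sum-map-filter P? h (x ∷ xs) with does (P? x)
... | true  = cong (h x +_) (sum-map-filter P? h xs)
... | false = sum-map-filter P? h xs

count≡sum : {P : A → Set} (P? : Decidable P) (xs : List A) →
  count P? xs ≡ sum (map (λ x → [ P? x ]· 1) xs)
count≡sum P? []       = refl
count≡sum P? (x ∷ xs) with does (P? x)
... | true  = cong suc (count≡sum P? xs)
... | false = count≡sum P? xs

sum-map-zero : (xs : List A) → sum (map (λ _ → 0) xs) ≡ 0
sum-map-zero []       = refl
sum-map-zero (x ∷ xs) = sum-map-zero xs

sum-map-+ : (f h : A → ℕ) (xs : List A) →
  sum (map (λ x → f x + h x) xs) ≡ sum (map f xs) + sum (map h xs)
sum-map-+ f h []       = refl
sum-map-+ f h (x ∷ xs) =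
  trans (cong (f x + h x +_) (sum-map-+ f h xs)) (+-interchange (f x) (h x) _ _)

sum-map-*ˡ : (c : ℕ) (f : A → ℕ) (xs : List A) → sum (map (λ x → c * f x) xs) ≡ c * sum (map f xs)
sum-map-*ˡ c f []       = sym (*-zeroʳ c)
sum-map-*ˡ c f (x ∷ xs) =
  trans (cong (c * f x +_) (sum-map-*ˡ c f xs)) (sym (*-distribˡ-+ c (f x) _))

sum-map-*ʳ : (f : A → ℕ) (c : ℕ) (xs : List A) → sum (map (λ x → f x * c) xs) ≡ sum (map f xs) * c
sum-map-*ʳ f c []       = refl
sum-map-*ʳ f c (x ∷ xs) =
  trans (cong (f x * c +_) (sum-map-*ʳ f c xs)) (sym (*-distribʳ-+ c (f x) _))

sum-map-swap : (F : A → B → ℕ) (xs : List A) (ys : List B) →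
  sum (map (λ x → sum (map (F x) ys)) xs) ≡ sum (map (λ y → sum (map (λ x → F x y) xs)) ys)
sum-map-swap F []       ys = sym (sum-map-zero ys)
sum-map-swap F (x ∷ xs) ys =
  trans (cong (sum (map (F x) ys) +_) (sum-map-swap F xs ys))
        (sym (sum-map-+ (F x) (λ y → sum (map (λ x → F x y) xs)) ys))

sum-map-∘ : (f : B → ℕ) (h : A → B) (xs : List A) → sum (map f (map h xs)) ≡ sum (map (f ∘ h) xs)
sum-map-∘ f h xs = cong sum (sym (map-∘ xs))

sum-map-concatMap : (f : B → ℕ) (h : A → List B) (xs : List A) →
  sum (map f (concatMap h xs)) ≡ sum (map (λ x → sum (map f (h x))) xs)
sum-map-concatMap f h []       = refl
sum-map-concatMap f h (x ∷ xs) = begin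
  sum (map f (h x ++ concatMap h xs))
    ≡⟨ cong sum (map-++ f (h x) (concatMap h xs)) ⟩
  sum (map f (h x) ++ map f (concatMap h xs))
    ≡⟨ sum-++ (map f (h x)) _ ⟩
  sum (map f (h x)) + sum (map f (concatMap h xs))
    ≡⟨ cong (sum (map f (h x)) +_) (sum-map-concatMap f h xs) ⟩
  sum (map f (h x)) + sum (map (λ x → sum (map f (h x))) xs) ∎
  where open ≡-Reasoning

δ : DecidableEquality A → A → A → ℕ
δ _≟_ a b = [ a ≟ b ]· 1

δ-sym : (_≟_ : DecidableEquality A) (a b : A) → δ _≟_ a b ≡ δ _≟_ b a
δ-sym _≟_ a b = []·-cong (mk⇔ sym sym) (a ≟ b) (b ≟ a) 1

δ-injective : (_≟A_ : DecidableEquality A) (_≟B_ : DecidableEquality B) {e : B → A} →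
  Injective _≡_ _≡_ e → (b b′ : B) → δ _≟A_ (e b) (e b′) ≡ δ _≟B_ b b′
δ-injective _≟A_ _≟B_ {e} e-inj b b′ =
  []·-cong (mk⇔ e-inj (cong e)) (e b ≟A e b′) (b ≟B b′) 1

δ-*-subst : (_≟_ : DecidableEquality A) (a b : A) (h : A → ℕ) → δ _≟_ a b * h b ≡ δ _≟_ a b * h a
δ-*-subst _≟_ a b h with a ≟ b
... | yes refl = refl
... | no _     = refl

Enumerates : DecidableEquality A → List A → Set
Enumerates {A} _≟_ xs = ∀ (a : A) → sum (map (δ _≟_ a) xs) ≡ 1

sum-map-δ-* : (_≟_ : DecidableEquality A) {xs : List A} → Enumerates _≟_ xs →
  (a : A) (h : A → ℕ) → sum (map (λ b → δ _≟_ a b * h b) xs) ≡ h a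
sum-map-δ-* _≟_ {xs} enum a h = begin
  sum (map (λ b → δ _≟_ a b * h b) xs) ≡⟨ sum-map-cong (λ b → δ-*-subst _≟_ a b h) xs ⟩
  sum (map (λ b → δ _≟_ a b * h a) xs) ≡⟨ sum-map-*ʳ (δ _≟_ a) (h a) xs ⟩
  sum (map (δ _≟_ a) xs) * h a         ≡⟨ cong (_* h a) (enum a) ⟩
  1 * h a                              ≡⟨ *-identityˡ (h a) ⟩
  h a                                  ∎
  where open ≡-Reasoning

sum-map-reindex : (_≟A_ : DecidableEquality A) (_≟B_ : DecidableEquality B)
  {xs : List A} {ys : List B} →
  Enumerates _≟A_ xs → Enumerates _≟B_ ys →
  (w : A → ℕ) (e : B → A) → Injective _≡_ _≡_ e → (∀ a → w a ≢ 0 → ∃ λ b → e b ≡ a) →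
  sum (map (w ∘ e) ys) ≡ sum (map w xs)
sum-map-reindex _≟A_ _≟B_ {xs} {ys} enumA enumB w e e-inj support = begin
  sum (map (w ∘ e) ys)
    ≡⟨ sum-map-cong (λ b → sum-map-δ-* _≟A_ {xs} enumA (e b) w) ys ⟨
  sum (map (λ b → sum (map (λ a → δ _≟A_ (e b) a * w a) xs)) ys)
    ≡⟨ sum-map-swap (λ a b → δ _≟A_ (e b) a * w a) xs ys ⟨
  sum (map (λ a → sum (map (λ b → δ _≟A_ (e b) a * w a) ys)) xs)
    ≡⟨ sum-map-cong (λ a → sum-map-*ʳ (λ b → δ _≟A_ (e b) a) (w a) ys) xs ⟩
  sum (map (λ a → sum (map (λ b → δ _≟A_ (e b) a) ys) * w a) xs)
    ≡⟨ sum-map-cong fibre xs ⟩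
  sum (map w xs) ∎
  where
  open ≡-Reasoning
  fibre : ∀ a → sum (map (λ b → δ _≟A_ (e b) a) ys) * w a ≡ w a
  fibre a with w a ≟ 0
  ... | yes w≡0 = trans (cong (s *_) w≡0) (trans (*-zeroʳ s) (sym w≡0))
    where
    s : ℕ
    s = sum (map (λ b → δ _≟A_ (e b) a) ys)
  ... | no w≢0 with support a w≢0
  ... | b₀ , refl = trans (cong (_* w (e b₀)) (begin
    sum (map (λ b → δ _≟A_ (e b) (e b₀)) ys)
      ≡⟨ sum-map-cong (λ b → δ-injective _≟A_ _≟B_ e-inj b b₀) ys ⟩
    sum (map (λ b → δ _≟B_ b b₀) ys)
      ≡⟨ sum-map-cong (λ b → δ-sym _≟B_ b b₀) ys ⟩
    sum (map (δ _≟B_ b₀) ys)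
      ≡⟨ enumB b₀ ⟩
    1 ∎)) (*-identityˡ (w (e b₀)))

δ-∷ : (_≟_ : DecidableEquality A) {k : ℕ} (a x : A) (as v : Vec A k) →
  δ (Vec.≡-dec _≟_) (a ∷ as) (x ∷ v) ≡ δ _≟_ a x * δ (Vec.≡-dec _≟_) as v
δ-∷ _≟_ a x as v with does (a ≟ x) | does (Vec.≡-dec _≟_ as v)
... | true  | true  = refl
... | true  | false = refl
... | false | _     = refl

enumerates-vecsOver : (_≟_ : DecidableEquality A) {xs : List A} → Enumerates _≟_ xs →
  (k : ℕ) → Enumerates (Vec.≡-dec _≟_) (vecsOver xs k)
enumerates-vecsOver _≟_ enum zero    []       = refl
enumerates-vecsOver _≟_ {xs} enum (suc k) (a ∷ as) = begin
  sum (map (δ _≟ᵛ_ (a ∷ as)) (concatMap (λ x → map (x ∷_) (vecsOver xs k)) xs))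
    ≡⟨ sum-map-concatMap (δ _≟ᵛ_ (a ∷ as)) (λ x → map (x ∷_) (vecsOver xs k)) xs ⟩
  sum (map (λ x → sum (map (δ _≟ᵛ_ (a ∷ as)) (map (x ∷_) (vecsOver xs k)))) xs)
    ≡⟨ sum-map-cong row xs ⟩
  sum (map (δ _≟_ a) xs)
    ≡⟨ enum a ⟩
  1 ∎
  where
  open ≡-Reasoning
  _≟ᵛ_ : ∀ {k} → DecidableEquality (Vec _ k)
  _≟ᵛ_ = Vec.≡-dec _≟_
  row : ∀ x → sum (map (δ _≟ᵛ_ (a ∷ as)) (map (x ∷_) (vecsOver xs k))) ≡ δ _≟_ a x
  row x = begin
    sum (map (δ _≟ᵛ_ (a ∷ as)) (map (x ∷_) (vecsOver xs k)))
      ≡⟨ sum-map-∘ (δ _≟ᵛ_ (a ∷ as)) (x ∷_) (vecsOver xs k) ⟩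
    sum (map (λ v → δ _≟ᵛ_ (a ∷ as) (x ∷ v)) (vecsOver xs k))
      ≡⟨ sum-map-cong (δ-∷ _≟_ a x as) (vecsOver xs k) ⟩
    sum (map (λ v → δ _≟_ a x * δ _≟ᵛ_ as v) (vecsOver xs k))
      ≡⟨ sum-map-*ˡ (δ _≟_ a x) (δ _≟ᵛ_ as) (vecsOver xs k) ⟩
    δ _≟_ a x * sum (map (δ _≟ᵛ_ as) (vecsOver xs k))
      ≡⟨ cong (δ _≟_ a x *_) (enumerates-vecsOver _≟_ enum k as) ⟩
    δ _≟_ a x * 1
      ≡⟨ *-identityʳ (δ _≟_ a x) ⟩
    δ _≟_ a x ∎

sum-map-allFin-suc : (k : ℕ) (f : Fin (suc k) → ℕ) →
  sum (map f (allFin (suc k))) ≡ f zero + sum (map (f ∘ suc) (allFin k))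
sum-map-allFin-suc k f = trans
  (cong (λ ys → f zero + sum (map f ys)) (sym (map-tabulate (λ i → i) suc)))
  (cong (f zero +_) (sum-map-∘ f suc (allFin k)))

enumerates-allFin : (k : ℕ) → Enumerates Fin._≟_ (allFin k)
enumerates-allFin (suc k) zero    =
  trans (sum-map-allFin-suc k (δ Fin._≟_ zero)) (cong suc (sum-map-zero (allFin k)))
enumerates-allFin (suc k) (suc a) =
  trans (sum-map-allFin-suc k (δ Fin._≟_ (suc a))) (enumerates-allFin k a)

enumerates-sides : Enumerates Bool._≟_ (inside ∷ outside ∷ [])
enumerates-sides true  = refl
enumerates-sides false = refl

x∈p─q⇒x∉q : ∀ {k} {x : Fin k} (p q : Subset k) → x ∈ p ─ q → x ∉ q
x∈p─q⇒x∉q (_ ∷ p) (outside ∷ q) here      ()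
x∈p─q⇒x∉q (_ ∷ p) (_ ∷ q)       (there x∈) (there x∈q) = x∈p─q⇒x∉q p q x∈ x∈q

x∉p─⁅x⁆ : ∀ {k} (p : Subset k) (x : Fin k) → x ∉ p ─ ⁅ x ⁆
x∉p─⁅x⁆ p x x∈ = x∈p─q⇒x∉q p ⁅ x ⁆ x∈ (x∈⁅x⁆ x)

decSubset : ∀ {k} {P : Fin k → Set} → Decidable P → Subset k
decSubset P? = tabulate (does ∘ P?)

∈-decSubset⁺ : ∀ {k} {P : Fin k → Set} (P? : Decidable P) {x : Fin k} → P x → x ∈ decSubset P?
∈-decSubset⁺ P? {x} px =
  Vec.lookup⇒[]= x _ (trans (Vec.lookup∘tabulate (does ∘ P?) x) (dec-true (P? x) px))

∈-decSubset⁻ : ∀ {k} {P : Fin k → Set} (P? : Decidable P) {x : Fin k} → x ∈ decSubset P? → P x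
∈-decSubset⁻ P? {x} x∈
  with P? x | trans (sym (Vec.lookup∘tabulate (does ∘ P?) x)) (Vec.[]=⇒lookup x∈)
... | yes px | _  = px
... | no _   | ()

module _ {m n : ℕ} where

  sublevel : Vec (Fin n) m → ℕ → Subset m
  sublevel f t = decSubset (λ x → toℕ (lookup f x) <? t)

  ∈-sublevel⁺ : ∀ f {t x} → toℕ (lookup f x) < t → x ∈ sublevel f t
  ∈-sublevel⁺ f {t} = ∈-decSubset⁺ (λ x → toℕ (lookup f x) <? t)

  ∈-sublevel⁻ : ∀ f t {x} → x ∈ sublevel f t → toℕ (lookup f x) < t
  ∈-sublevel⁻ f t = ∈-decSubset⁻ (λ x → toℕ (lookup f x) <? t)

  levels : Vec (Fin n) m → Vec (Subset m) n
  levels f = tabulate (λ i → decSubset (λ x → lookup f x Fin.≟ i))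

  ∈-levels⁺ : ∀ f {i x} → lookup f x ≡ i → x ∈ lookup (levels f) i
  ∈-levels⁺ f {i} fx≡i = subst (_ ∈_) (sym (Vec.lookup∘tabulate _ i))
    (∈-decSubset⁺ (λ x → lookup f x Fin.≟ i) fx≡i)

  ∈-levels⁻ : ∀ f i {x} → x ∈ lookup (levels f) i → lookup f x ≡ i
  ∈-levels⁻ f i x∈ = ∈-decSubset⁻ (λ x → lookup f x Fin.≟ i)
    (subst (_ ∈_) (Vec.lookup∘tabulate _ i) x∈)

  levels-injective : Injective _≡_ _≡_ levels
  levels-injective {f} {f′} levels≡ = Pointwise-≡⇒≡ (ext λ x → sym (∈-levels⁻ f′ (lookup f x)
    (subst (λ S → x ∈ lookup S (lookup f x)) levels≡ (∈-levels⁺ f refl))))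

module _ {m : ℕ} (G : ConvexGeometry m) where
  open ConvexGeometry G

  closure-convex : ∀ A → Convex G (g A)
  closure-convex = idempotent

  closure-least : ∀ {A K} → Convex G K → A ⊆ K → g A ⊆ K
  closure-least {A} {K} K-convex A⊆K = subst (g A ⊆_) K-convex (monotone A K A⊆K)

  closed⇒convex : ∀ {A} → g A ⊆ A → Convex G A
  closed⇒convex {A} gA⊆A = ⊆-antisym gA⊆A (extensive A)

  convex-∩ : ∀ {A B} → Convex G A → Convex G B → Convex G (A ∩ B)
  convex-∩ {A} {B} A-convex B-convex = closed⇒convex λ x∈ →
    x∈p∩q⁺ (closure-least A-convex (p∩q⊆p A B) x∈ , closure-least B-convex (p∩q⊆q A B) x∈)

  ∉-closure : ∀ {A K x} → Convex G (K ─ ⁅ x ⁆) → A ⊆ K → x ∉ A → x ∉ g A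
  ∉-closure {A} {K} {x} convex A⊆K x∉A x∈gA = x∉p─⁅x⁆ K x (closure-least convex A⊆K─x x∈gA)
    where
    A⊆K─x : A ⊆ K ─ ⁅ x ⁆
    A⊆K─x y∈A = x∈p∧x∉q⇒x∈p─q (A⊆K y∈A) λ y∈⁅x⁆ → x∉A (subst (_∈ A) (x∈⁅y⁆⇒x≡y x y∈⁅x⁆) y∈A)

  closure-∪-⁅⁆⊆ : ∀ {C K y} → Convex G K → C ⊆ K → y ∈ K → g (C ∪ ⁅ y ⁆) ⊆ K
  closure-∪-⁅⁆⊆ {C} {K} {y} K-convex C⊆K y∈K = closure-least K-convex λ x∈ →
    [ C⊆K , (λ x∈⁅y⁆ → subst (_∈ K) (sym (x∈⁅y⁆⇒x≡y y x∈⁅y⁆)) y∈K) ]′ (x∈p∪q⁻ C ⁅ y ⁆ x∈)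

  ⊆-closure-∪-⁅⁆ : ∀ C y → C ⊆ g (C ∪ ⁅ y ⁆)
  ⊆-closure-∪-⁅⁆ C y x∈C = extensive (C ∪ ⁅ y ⁆) (p⊆p∪q ⁅ y ⁆ x∈C)

  ⊂-closure-∪-⁅⁆ : ∀ {C y} → y ∉ C → C ⊂ g (C ∪ ⁅ y ⁆)
  ⊂-closure-∪-⁅⁆ {C} {y} y∉C =
    ⊆-closure-∪-⁅⁆ C y , y , extensive (C ∪ ⁅ y ⁆) (q⊆p∪q C ⁅ y ⁆ (x∈⁅x⁆ y)) , y∉C

  -- Recursion on C ⊂ K: if some w ∈ K avoids g (C ∪ {y}), grow C to that closure and aim at w;
  -- else if some w ≠ y lies in K ∖ C, anti-exchange keeps y outside g (C ∪ {w}), so grow C to it;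
  -- else K ∖ C = {y} and y is extreme.
  extreme-point-outside : ∀ {C K y} → Convex G C → Convex G K → C ⊆ K → y ∈ K → y ∉ C →
    ∃ λ z → _∈Ex_ G z K × z ∉ C
  extreme-point-outside {C} = go (⊃-wellFounded C)
    where
    go : ∀ {C K y} → Acc _⊃_ C → Convex G C → Convex G K → C ⊆ K → y ∈ K → y ∉ C →
      ∃ λ z → _∈Ex_ G z K × z ∉ C
    go {C} {K} {y} (acc rec) C-convex K-convex C⊆K y∈K y∉C
      with any? (λ w → (w ∈? K) ×-dec ¬? (w ∈? g (C ∪ ⁅ y ⁆)))
    ... | yes (w , w∈K , w∉D)
      with go (rec (⊂-closure-∪-⁅⁆ y∉C)) (closure-convex _) K-convex
              (closure-∪-⁅⁆⊆ K-convex C⊆K y∈K) w∈K w∉D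
    ... | z , z-extreme , z∉D = z , z-extreme , z∉D ∘ ⊆-closure-∪-⁅⁆ C y
    go {C} {K} {y} (acc rec) C-convex K-convex C⊆K y∈K y∉C | no K⊆D
      with any? (λ w → (w ∈? K) ×-dec ¬? (w ∈? C) ×-dec ¬? (w Fin.≟ y))
    ... | yes (w , w∈K , w∉C , w≢y)
      with go (rec (⊂-closure-∪-⁅⁆ w∉C)) (closure-convex _) K-convex
              (closure-∪-⁅⁆⊆ K-convex C⊆K w∈K) y∈K y∉C′
      where
      w∈D : w ∈ g (C ∪ ⁅ y ⁆)
      w∈D = decidable-stable (w ∈? g (C ∪ ⁅ y ⁆)) λ w∉D → K⊆D (w , w∈K , w∉D)
      y∉C′ : y ∉ g (C ∪ ⁅ w ⁆)
      y∉C′ = anti-exchange C w y w≢y (subst (w ∉_) (sym C-convex) w∉C)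
                                      (subst (y ∉_) (sym C-convex) y∉C) w∈D
    ... | z , z-extreme , z∉C′ = z , z-extreme , z∉C′ ∘ ⊆-closure-∪-⁅⁆ C w
    go {C} {K} {y} _ C-convex K-convex C⊆K y∈K y∉C | no K⊆D | no K─C⊆⁅y⁆ =
      y , (y∈K , subst (Convex G) (sym K─y≡C) C-convex) , y∉C
      where
      K─y⊆C : K ─ ⁅ y ⁆ ⊆ C
      K─y⊆C {x} x∈ = decidable-stable (x ∈? C) λ x∉C →
        K─C⊆⁅y⁆ (x , p─q⊆p K ⁅ y ⁆ x∈ , x∉C , λ x≡y →
          x∈p─q⇒x∉q K ⁅ y ⁆ x∈ (subst (_∈ ⁅ y ⁆) (sym x≡y) (x∈⁅x⁆ y)))
      C⊆K─y : C ⊆ K ─ ⁅ y ⁆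
      C⊆K─y x∈C = x∈p∧x∉q⇒x∈p─q (C⊆K x∈C) λ x∈⁅y⁆ → y∉C (subst (_∈ C) (x∈⁅y⁆⇒x≡y y x∈⁅y⁆) x∈C)
      K─y≡C : K ─ ⁅ y ⁆ ≡ C
      K─y≡C = ⊆-antisym K─y⊆C C⊆K─y

  maximum-exists : ∀ {n} (f : Vec (Fin n) m) {K} → Nonempty K → ∃ (AttainsMax G f K)
  maximum-exists {n} f {K} (y , y∈K) =
    x , argmax-all (lookup f) {P = _∈ K} y∈K (all-filter (_∈? K) (allFin m)) , x-max
    where
    open import Data.List.Extrema (Fin.≤-totalOrder n) using (argmax; argmax-all; f[xs]≤f[argmax])
    elements : List (Fin m)
    elements = filter (_∈? K) (allFin m)
    x : Fin m
    x = argmax (lookup f) y elements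
    x-max : ∀ z → z ∈ K → toℕ (lookup f z) ≤ toℕ (lookup f x)
    x-max z z∈K = All.lookup (f[xs]≤f[argmax] y elements) (∈-filter⁺ (_∈? K) (∈-allFin z) z∈K)

  module _ {n : ℕ} (f : Vec (Fin n) m) where

    extremal⇒convex-sublevel : Extremal G f → ∀ t → Convex G (sublevel f t)
    extremal⇒convex-sublevel extremal t = closed⇒convex λ {y} y∈gL →
      let x , (x∈gL , x-max) , (_ , x-extreme) = extremal (g L) (closure-convex L) (y , y∈gL)
          x∈L = decidable-stable (x ∈? L) λ x∉L → ∉-closure x-extreme (extensive L) x∉L x∈gL
      in ∈-sublevel⁺ f (≤-<-trans (x-max y y∈gL) (∈-sublevel⁻ f t x∈L))
      where
      L : Subset m
      L = sublevel f t

    convex-sublevel⇒extremal : (∀ (i : Fin n) → Convex G (sublevel f (toℕ i))) → Extremal G f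
    convex-sublevel⇒extremal convex K K-convex K≢∅ =
      let x , x∈K , x-max = maximum-exists f K≢∅
          C = K ∩ sublevel f (toℕ (lookup f x))
          x∉C : x ∉ C
          x∉C x∈C = <-irrefl refl (∈-sublevel⁻ f _ (proj₂ (x∈p∩q⁻ K _ x∈C)))
          z , z-extreme , z∉C = extreme-point-outside (convex-∩ K-convex (convex (lookup f x)))
                                  K-convex (p∩q⊆p K _) x∈K x∉C
          z∈K = proj₁ z-extreme
          fx≤fz = ≮⇒≥ λ fz<fx → z∉C (x∈p∩q⁺ (z∈K , ∈-sublevel⁺ f fz<fx))
      in z , (z∈K , λ y y∈K → ≤-trans (x-max y y∈K) fx≤fz) , z-extreme

    strictlyExtremal⇒extremal : StrictlyExtremal G f → Extremal G f
    strictlyExtremal⇒extremal strict K K-convex K≢∅ =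
      let x , x-max = maximum-exists f K≢∅ in x , x-max , strict K K-convex K≢∅ x x-max

    strictlyExtremal⇒discrete : StrictlyExtremal G f →
      ∀ t → DiscreteMinor G (sublevel f t) (sublevel f (suc t))
    strictlyExtremal⇒discrete strict t X X⊆U─L = ⊆-antisym minor⊆X X⊆minor
      where
      L U : Subset m
      L = sublevel f t
      U = sublevel f (suc t)
      X⊆minor : X ⊆ minor G L U X
      X⊆minor x∈X = x∈p∩q⁺ (extensive (L ∪ X) (q⊆p∪q L X x∈X) , X⊆U─L x∈X)
      L∪X⊆U : L ∪ X ⊆ U
      L∪X⊆U x∈ = [ (λ x∈L → ∈-sublevel⁺ f (m<n⇒m<1+n (∈-sublevel⁻ f t x∈L))) , p─q⊆p U L ∘ X⊆U─L ]′
                   (x∈p∪q⁻ L X x∈)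
      closure⊆U : g (L ∪ X) ⊆ U
      closure⊆U = closure-least
        (extremal⇒convex-sublevel (strictlyExtremal⇒extremal strict) (suc t)) L∪X⊆U
      minor⊆X : minor G L U X ⊆ X
      minor⊆X {y} y∈ = decidable-stable (y ∈? X) λ y∉X →
        ∉-closure y-extreme (extensive (L ∪ X)) ([ y∉L , y∉X ]′ ∘ x∈p∪q⁻ L X) y∈K
        where
        y∈K : y ∈ g (L ∪ X)
        y∈K = proj₁ (x∈p∩q⁻ _ _ y∈)
        y∉L : y ∉ L
        y∉L = x∈p─q⇒x∉q U L (proj₂ (x∈p∩q⁻ _ _ y∈))
        y-max : AttainsMax G f (g (L ∪ X)) y
        y-max = y∈K , λ z z∈K → ≤-trans (≤-pred (∈-sublevel⁻ f (suc t) (closure⊆U z∈K)))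
                                        (≮⇒≥ (y∉L ∘ ∈-sublevel⁺ f))
        y-extreme : Convex G (g (L ∪ X) ─ ⁅ y ⁆)
        y-extreme = proj₂ (strict _ (closure-convex _) (y , y∈K) y y-max)

    discrete⇒strictlyExtremal :
      (∀ (i : Fin n) → DiscreteMinor G (sublevel f (toℕ i)) (sublevel f (suc (toℕ i)))) →
      StrictlyExtremal G f
    discrete⇒strictlyExtremal discrete K K-convex _ x (x∈K , x-max) =
      x∈K , closed⇒convex closure⊆K─x
      where
      L U X : Subset m
      L = sublevel f (toℕ (lookup f x))
      U = sublevel f (suc (toℕ (lookup f x)))
      X = K ─ ⁅ x ⁆ ─ L
      X⊆U─L : X ⊆ U ─ L
      X⊆U─L z∈X = x∈p∧x∉q⇒x∈p─q (∈-sublevel⁺ f (s≤s (x-max _ (p─q⊆p K _ (p─q⊆p _ L z∈X)))))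
                                 (x∈p─q⇒x∉q _ L z∈X)
      x∈U─L : x ∈ U ─ L
      x∈U─L = x∈p∧x∉q⇒x∈p─q (∈-sublevel⁺ f ≤-refl) (<-irrefl refl ∘ ∈-sublevel⁻ f _)
      x∉closure : x ∉ g (L ∪ X)
      x∉closure x∈ = x∉p─⁅x⁆ K x (p─q⊆p _ L
        (subst (x ∈_) (discrete (lookup f x) X X⊆U─L) (x∈p∩q⁺ (x∈ , x∈U─L))))
      K─x⊆L∪X : K ─ ⁅ x ⁆ ⊆ L ∪ X
      K─x⊆L∪X {z} z∈ with z ∈? L
      ... | yes z∈L = p⊆p∪q X z∈L
      ... | no z∉L  = q⊆p∪q L X (x∈p∧x∉q⇒x∈p─q z∈ z∉L)
      closure⊆K─x : g (K ─ ⁅ x ⁆) ⊆ K ─ ⁅ x ⁆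
      closure⊆K─x z∈ = x∈p∧x∉q⇒x∈p─q (closure-least K-convex (p─q⊆p K _) z∈) λ z∈⁅x⁆ →
        x∉closure (subst (_∈ g (L ∪ X)) (x∈⁅y⁆⇒x≡y x z∈⁅x⁆) (monotone _ _ K─x⊆L∪X z∈))

  ∈-prefix⁻ : ∀ {n} (S : Vec (Subset m) n) j {x} → x ∈ prefix G S j →
    ∃ λ i → toℕ i < toℕ j × x ∈ lookup S i
  ∈-prefix⁻ S       zero    x∈ = ⊥-elim (∉⊥ x∈)
  ∈-prefix⁻ (s ∷ S) (suc j) x∈ with x∈p∪q⁻ s (prefix G S j) x∈
  ... | inj₁ x∈s = zero , s≤s z≤n , x∈s
  ... | inj₂ x∈S = let i , i<j , x∈Sᵢ = ∈-prefix⁻ S j x∈S in suc i , s≤s i<j , x∈Sᵢ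

  ∈-prefix⁺ : ∀ {n} (S : Vec (Subset m) n) j i {x} →
    toℕ i < toℕ j → x ∈ lookup S i → x ∈ prefix G S j
  ∈-prefix⁺ (s ∷ S) (suc j) zero    _         x∈ = x∈p∪q⁺ (inj₁ x∈)
  ∈-prefix⁺ (s ∷ S) (suc j) (suc i) (s≤s i<j) x∈ = x∈p∪q⁺ (inj₂ (∈-prefix⁺ S j i i<j x∈))

  module _ {n : ℕ} (f : Vec (Fin n) m) where

    prefix-levels : ∀ j → prefix G (levels f) j ≡ sublevel f (toℕ j)
    prefix-levels j = ⊆-antisym
      (λ x∈ → let i , i<j , x∈i = ∈-prefix⁻ (levels f) j x∈
              in ∈-sublevel⁺ f (subst (λ k → toℕ k < toℕ j) (sym (∈-levels⁻ f i x∈i)) i<j))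
      (λ {x} x∈ → ∈-prefix⁺ (levels f) j (lookup f x) (∈-sublevel⁻ f _ x∈) (∈-levels⁺ f refl))

    prefix-levels-inject₁ : ∀ i → prefix G (levels f) (inject₁ i) ≡ sublevel f (toℕ i)
    prefix-levels-inject₁ i =
      trans (prefix-levels (inject₁ i)) (cong (sublevel f) (Fin.toℕ-inject₁ i))

    validSeq-levels⇔ : ValidSeq G (levels f) ⇔ (∀ (j : Fin (suc n)) → Convex G (sublevel f (toℕ j)))
    validSeq-levels⇔ = mk⇔
      (λ (_ , _ , convex) j → subst (Convex G) (prefix-levels j) (convex j))
      (λ convex → disjoint , cover , λ j → subst (Convex G) (sym (prefix-levels j)) (convex j))
      where
      disjoint : ∀ i j → i ≢ j → lookup (levels f) i ∩ lookup (levels f) j ≡ ⊥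
      disjoint i j i≢j = ⊆-antisym
        (λ x∈ → let x∈i , x∈j = x∈p∩q⁻ _ _ x∈
                in ⊥-elim (i≢j (trans (sym (∈-levels⁻ f i x∈i)) (∈-levels⁻ f j x∈j))))
        ⊥⊆
      cover : prefix G (levels f) (fromℕ n) ≡ ⊤
      cover = trans (prefix-levels (fromℕ n)) (⊆-antisym ⊆⊤ λ {x} _ →
        ∈-sublevel⁺ f (subst (toℕ (lookup f x) <_) (sym (Fin.toℕ-fromℕ n))
                             (Fin.toℕ<n (lookup f x))))

    validSeq-levels⇔extremal : ValidSeq G (levels f) ⇔ Extremal G f
    validSeq-levels⇔extremal = mk⇔
      (λ valid → convex-sublevel⇒extremal f λ i →
        subst (λ t → Convex G (sublevel f t)) (Fin.toℕ-inject₁ i)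
              (Equivalence.to validSeq-levels⇔ valid (inject₁ i)))
      (λ extremal → Equivalence.from validSeq-levels⇔ (extremal⇒convex-sublevel f extremal ∘ toℕ))

    DiscreteStepMinors : Set
    DiscreteStepMinors =
      ∀ (i : Fin n) → DiscreteMinor G (prefix G (levels f) (inject₁ i)) (prefix G (levels f) (suc i))

    validSeq-discrete-levels⇔strictlyExtremal :
      (ValidSeq G (levels f) × DiscreteStepMinors) ⇔ StrictlyExtremal G f
    validSeq-discrete-levels⇔strictlyExtremal = mk⇔
      (λ (_ , discrete) → discrete⇒strictlyExtremal f λ i →
        subst₂ (DiscreteMinor G) (prefix-levels-inject₁ i) (prefix-levels (suc i)) (discrete i))
      (λ strict → Equivalence.from validSeq-levels⇔extremal (strictlyExtremal⇒extremal f strict) ,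
        λ i →
        subst₂ (DiscreteMinor G) (sym (prefix-levels-inject₁ i)) (sym (prefix-levels (suc i)))
          (strictlyExtremal⇒discrete f strict (toℕ i)))

  validSeq⇒levels : ∀ {n} {S : Vec (Subset m) n} → ValidSeq G S → ∃ λ f → levels f ≡ S
  validSeq⇒levels {n} {S} (disjoint , cover , _) =
    f , Pointwise-≡⇒≡ (ext λ i → ⊆-antisym (levels⊆S i) (S⊆levels i))
    where
    f : Vec (Fin n) m
    f = tabulate λ x → proj₁ (∈-prefix⁻ S (fromℕ n) (subst (x ∈_) (sym cover) ∈⊤))
    x∈S[fx] : ∀ x → x ∈ lookup S (lookup f x)
    x∈S[fx] x = subst (λ i → x ∈ lookup S i) (sym (Vec.lookup∘tabulate _ x))
                  (proj₂ (proj₂ (∈-prefix⁻ S (fromℕ n) (subst (x ∈_) (sym cover) ∈⊤))))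
    levels⊆S : ∀ i → lookup (levels f) i ⊆ lookup S i
    levels⊆S i x∈ = subst (λ j → _ ∈ lookup S j) (∈-levels⁻ f i x∈) (x∈S[fx] _)
    S⊆levels : ∀ i → lookup S i ⊆ lookup (levels f) i
    S⊆levels i {x} x∈ = ∈-levels⁺ f (decidable-stable (lookup f x Fin.≟ i) λ fx≢i →
      ∉⊥ (subst (x ∈_) (disjoint _ _ fx≢i) (x∈p∩q⁺ (x∈S[fx] x , x∈))))

  prodFin-ones : ∀ k {h : Fin k → ℕ} → (∀ i → h i ≡ 1) → prodFin G k h ≡ 1
  prodFin-ones zero    _    = refl
  prodFin-ones (suc k) h≡1 = cong₂ _*_ (h≡1 zero) (prodFin-ones k (h≡1 ∘ suc))

  prodFin-zero : ∀ k {h : Fin k → ℕ} i → h i ≡ 0 → prodFin G k h ≡ 0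
  prodFin-zero (suc k) {h} zero    hᵢ≡0 = cong (_* prodFin G k (h ∘ suc)) hᵢ≡0
  prodFin-zero (suc k) {h} (suc i) hᵢ≡0 =
    trans (cong (h zero *_) (prodFin-zero k i hᵢ≡0)) (*-zeroʳ (h zero))

  prodFin-indicators : ∀ k {h : Fin k → ℕ} {P : Fin k → Set} (P? : Decidable P) →
    (∀ i → h i ≡ [ P? i ]· 1) → prodFin G k h ≡ [ all? P? ]· 1
  prodFin-indicators k P? h≡ with all? P?
  ... | yes all = trans (prodFin-ones k λ i → trans (h≡ i) ([]·-yes (P? i) (all i) 1))
                        (sym ([]·-yes (all? P?) all 1))
  ... | no ¬all = let i , ¬Pᵢ = Fin.¬∀⟶∃¬ k _ P? ¬all
                  in trans (prodFin-zero k i (trans (h≡ i) ([]·-no (P? i) ¬Pᵢ 1)))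
                           (sym ([]·-no (all? P?) ¬all 1))

  ζ≡[]· : ∀ A B → ζ G A B ≡ [ discreteMinor? G A B ]· 1
  ζ≡[]· A B with discreteMinor? G A B
  ... | yes _ = refl
  ... | no _  = refl

  minorProduct : ∀ {n} → MinorCharacter G → Vec (Subset m) n → ℕ
  minorProduct {n} ψ S = prodFin G n (λ i → ψ (prefix G S (inject₁ i)) (prefix G S (suc i)))

  module _ {n : ℕ} (f : Vec (Fin n) m) where

    η-weight : [ validSeq? G (levels f) ]· minorProduct (η G) (levels f) ≡ [ extremal? G f ]· 1
    η-weight = trans (cong ([ validSeq? G (levels f) ]·_) (prodFin-ones n λ _ → refl))
      ([]·-cong (validSeq-levels⇔extremal f) (validSeq? G (levels f)) (extremal? G f) 1)

    ζ-weight : [ validSeq? G (levels f) ]· minorProduct (ζ G) (levels f) ≡ [ strictlyExtremal? G f ]· 1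
    ζ-weight = begin
      [ valid? ]· minorProduct (ζ G) (levels f)
        ≡⟨ cong ([ valid? ]·_) (prodFin-indicators n discrete? (λ i → ζ≡[]· _ _)) ⟩
      [ valid? ]· [ all? discrete? ]· 1
        ≡⟨ []·-×-dec valid? (all? discrete?) 1 ⟩
      [ valid? ×-dec all? discrete? ]· 1
        ≡⟨ []·-cong (validSeq-discrete-levels⇔strictlyExtremal f)
                    (valid? ×-dec all? discrete?) (strictlyExtremal? G f) 1 ⟩
      [ strictlyExtremal? G f ]· 1 ∎
      where
      open ≡-Reasoning
      valid? : Dec (ValidSeq G (levels f))
      valid? = validSeq? G (levels f)
      discrete? : ∀ i → Dec (DiscreteMinor G (prefix G (levels f) (inject₁ i)) (prefix G (levels f) (suc i)))
      discrete? i = discreteMinor? G _ _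

  chi≡count : ∀ {n} (ψ : MinorCharacter G) {P : Vec (Fin n) m → Set} (P? : Decidable P) →
    (∀ f → [ validSeq? G (levels f) ]· minorProduct ψ (levels f) ≡ [ P? f ]· 1) →
    chi G ψ n ≡ count P? (allFunctions m n)
  chi≡count {n} ψ P? weight = begin
    chi G ψ n
      ≡⟨ sum-map-filter (validSeq? G) (minorProduct ψ) (allSeqs G n) ⟩
    sum (map w (allSeqs G n))
      ≡⟨ sum-map-reindex (Vec.≡-dec _≟ˢ_) (Vec.≡-dec Fin._≟_) {allSeqs G n} {allFunctions m n}
           enumerates-allSeqs enumerates-allFunctions
           w levels levels-injective support ⟨
    sum (map (w ∘ levels) (allFunctions m n))
      ≡⟨ sum-map-cong weight (allFunctions m n) ⟩
    sum (map (λ f → [ P? f ]· 1) (allFunctions m n))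
      ≡⟨ count≡sum P? (allFunctions m n) ⟨
    count P? (allFunctions m n) ∎
    where
    open ≡-Reasoning
    w : Vec (Subset m) n → ℕ
    w S = [ validSeq? G S ]· minorProduct ψ S
    support : ∀ S → w S ≢ 0 → ∃ λ f → levels f ≡ S
    support S w≢0 = validSeq⇒levels ([]·≢0⇒ (validSeq? G S) w≢0)
    enumerates-allSeqs : Enumerates (Vec.≡-dec _≟ˢ_) (allSeqs G n)
    enumerates-allSeqs =
      enumerates-vecsOver _≟ˢ_ (enumerates-vecsOver Bool._≟_ enumerates-sides m) n
    enumerates-allFunctions : Enumerates (Vec.≡-dec Fin._≟_) (allFunctions m n)
    enumerates-allFunctions = enumerates-vecsOver Fin._≟_ (enumerates-allFin n) m

mainTheorem5 : (m : ℕ) (G : ConvexGeometry m) (n : ℕ) →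
    (chi G (η G) n ≡ count (extremal? G {n}) (allFunctions m n)) ×
    (chi G (ζ G) n ≡ count (strictlyExtremal? G {n}) (allFunctions m n))
mainTheorem5 m G n =
  chi≡count G (η G) (extremal? G) (η-weight G) ,
  chi≡count G (ζ G) (strictlyExtremal? G) (ζ-weight G)
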